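{- Let $d$ be a derivation in the system $\mathrm{BI}^{ - }$ whose end-sequent $\Gamma(d)$ is a $\Pi^1$-sequent. Then there exists a cut-free derivation $d'$ in $\mathrm{BI}^{ - }$ (i.e. a derivation in $\mathrm{BI}^{ - }$ containing no $\mathrm{Cut}$ inference) with $\Gamma(d') = \Gamma(d)$.
   Context: Language $L$: terms are built from $0$ by the successor $S$ (closed terms are numerals $\bar n$). Atomic formulas are $R(t_1,\dots,t_n)$, where $R$ is a predicate symbol for an $n$-ary primitive recursive relation, and $X(t)$, where $X$ is a unary set variable. Literals are atomic formulas $A$ and their negations $\neg A$. Formulas are built from literals by $\wedge,\vee$, number quantifiers ($\forall x A(x)$, $\exists x A(x)$ are formulas whenever $A(0)$ is, so formulas have no free number variables), and second-order quantifiers $\forall X A$, $\exists X A$, allowed only when $A$ contains no second-order quantifier and no free set variable other than $X$. For non-atomic $A$, $\neg A$ is defined by De Morgan's laws (e.g. $\neg\forall X A = \exists X \neg A$, $\neg\neg A=A$ for atomic $A$). TRUE is the set of true closed literals of the form $R(\vec n)$ or $\neg R(\vec n)$. A $\Pi^1$-formula is a formula with no subformula of the form $\exists X A(X)$; a $\Pi^1$-sequent is a finite set of $\Pi^1$-formulas. Sequents are finite sets of formulas, $\Gamma, A$ denotes $\Gamma\cup\{A\}$. An abstraction is $T=\lambda x.B$ where $B(0)$ is a formula; $A(X/T)$ is the result of replacing each occurrence $X(t)$ in $A$ by $B(t)$. Derivations (Tait-style, infinitary): each inference symbol $I$ has a set $\Delta(I)$ of principal formulas, an index set $|I|$, and for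 each $i\in|I|$ a set $\Delta_i(I)$ of minor formulas. A derivation $d=I(d_i)_{i\in|I|}$ is a well-founded (possibly infinitely branching) tree labelled by sequents and inference symbols such that, writing $\Gamma(d)$ for the sequent at the root, $\Delta(I)\subseteq\Gamma(d)$ and $\Gamma(d_i)\subseteq \Gamma(d)\cup\Delta_i(I)$ for every $i\in|I|$; an eigenvariable of an inference does not occur free in its conclusion. The rules of $\mathrm{BI}^{ - }$: $\mathrm{Ax}_\Delta$ (no premises, $\Delta(I)=\Delta$) where $\Delta=\{A\}\subseteq$ TRUE or $\Delta=\{C,\neg C\}$ for a formula $C$; $\bigwedge_{A_0\wedge A_1}$ with $\Delta=\{A_0\wedge A_1\}$, index set $\{0,1\}$, $\Delta_i=\{A_i\}$; $\bigvee^k_{A_0\vee A_1}$ ($k\in\{0,1\}$) with $\Delta=\{A_0\vee A_1\}$, one premise with $\Delta_0=\{A_k\}$; $\bigwedge_{\forall x A}$ ($\omega$-rule) with $\Delta=\{\forall xA\}$, index set $\omega$, $\Delta_n=\{A(\bar n)\}$; $\bigvee^k_{\exists x A}$ ($k\in\omega$) with $\Delta=\{\exists xA\}$, $\Delta_0=\{A(\bar k)\}$; $\bigwedge_{\forall X A}$ with $\Delta=\{\forall XA\}$, $\Delta_0=\{A(X/Y)\}$ where $Y$ is an eigenvariable; $\bigvee^T_{\neg\forall XA}$ for an abstraction $T$, with $\Delta=\{\neg\forall X A\}$, $\Delta_0=\{\neg A(X/T)\}$; $\mathrm{Cut}_A$ with $\Delta=\emptyset$, index set $\{0,1\}$, $\Delta_0=\{A\}$,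 $\Delta_1=\{\neg A\}$. -}

module Defs where

open import Data.Nat using (ℕ; zero; suc)
open import Data.Fin using (Fin; zero; suc)
open import Data.Vec using (Vec; []; _∷_; lookup)
import Data.Vec as Vec
open import Data.Bool using (Bool; true; false)
open import Data.Unit using (⊤; tt)
open import Data.Empty using (⊥)
open import Data.Product using (Σ; _×_; _,_; proj₁; proj₂)
open import Data.Sum using (_⊎_)
open import Data.List using (List; _∷_; [])
open import Data.List.Membership.Propositional using (_∈_)
open import Data.List.Relation.Binary.Subset.Propositional using (_⊆_)
open import Data.List.Relation.Unary.All using (All)
open import Relation.Binary.PropositionalEquality using (_≡_)
open import Relation.Nullary using (¬_)

data PR : ℕ → Set where
  Z    : ∀ {k} → PR k
  Sc   : PR 1
  P    : ∀ {k} → Fin k → PR k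
  Comp : ∀ {k m} → PR m → Vec (PR k) m → PR k
  Rec  : ∀ {k} → PR k → PR (suc (suc k)) → PR (suc k)

mutual
  evalPR : ∀ {k} → PR k → Vec ℕ k → ℕ
  evalPR Z xs = 0
  evalPR Sc (x ∷ []) = suc x
  evalPR (P i) xs = lookup xs i
  evalPR (Comp f gs) xs = evalPR f (evalPRs gs xs)
  evalPR (Rec g h) (zero ∷ xs) = evalPR g xs
  evalPR (Rec g h) (suc n ∷ xs) = evalPR h (n ∷ evalPR (Rec g h) (n ∷ xs) ∷ xs)

  evalPRs : ∀ {k m} → Vec (PR k) m → Vec ℕ k → Vec ℕ m
  evalPRs [] xs = []
  evalPRs (g ∷ gs) xs = evalPR g xs ∷ evalPRs gs xs

-- A predicate symbol for a k-ary primitive recursive relation is given by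
-- (a code of) its primitive recursive characteristic function.
RelSym : Set
RelSym = Σ ℕ PR

arity : RelSym → ℕ
arity = proj₁

Holds : (R : RelSym) → Vec ℕ (arity R) → Set
Holds (k , f) xs = evalPR f xs ≡ 1

data Tm (n : ℕ) : Set where
  var  : Fin n → Tm n
  zer  : Tm n
  succ : Tm n → Tm n

num : ∀ {n} → ℕ → Tm n
num zero = zer
num (suc k) = succ (num k)

renTm : ∀ {m n} → (Fin m → Fin n) → Tm m → Tm n
renTm ρ (var i) = var (ρ i)
renTm ρ zer = zer
renTm ρ (succ t) = succ (renTm ρ t)

subTm : ∀ {m n} → (Fin m → Tm n) → Tm m → Tm n
subTm σ (var i) = σ i
subTm σ zer = zer
subTm σ (succ t) = succ (subTm σ t)

liftSub : ∀ {m n} → (Fin m → Tm n) → Fin (suc m) → Tm (suc n)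
liftSub σ zero = var zero
liftSub σ (suc i) = renTm suc (σ i)

evalTm : Tm 0 → ℕ
evalTm (var ())
evalTm zer = 0
evalTm (succ t) = suc (evalTm t)

-- F V b n : formulas whose free set variables range over V, with n number
-- variables in scope; b = false forbids second-order quantifiers.
-- The body of a second-order quantifier ∀X / ∃X contains no second-order
-- quantifier and no free set variable other than X: it is an element of
-- F ⊤ false n, where the unique element tt of ⊤ stands for X.

data F (V : Set) : Bool → ℕ → Set where
  rel  : ∀ {b n} (R : RelSym) → Vec (Tm n) (arity R) → F V b n
  nrel : ∀ {b n} (R : RelSym) → Vec (Tm n) (arity R) → F V b n
  mem  : ∀ {b n} → V → Tm n → F V b n
  nmem : ∀ {b n} → V → Tm n → F V b n
  and  : ∀ {b n} → F V b n → F V b n → F V b n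
  or   : ∀ {b n} → F V b n → F V b n → F V b n
  all  : ∀ {b n} → F V b (suc n) → F V b n
  ex   : ∀ {b n} → F V b (suc n) → F V b n
  all2 : ∀ {n} → F ⊤ false n → F V true n
  ex2  : ∀ {n} → F ⊤ false n → F V true n

Form : Set
Form = F ℕ true 0

Seq : Set
Seq = List Form

neg : ∀ {V b n} → F V b n → F V b n
neg (rel R ts) = nrel R ts
neg (nrel R ts) = rel R ts
neg (mem X t) = nmem X t
neg (nmem X t) = mem X t
neg (and A B) = or (neg A) (neg B)
neg (or A B) = and (neg A) (neg B)
neg (all A) = ex (neg A)
neg (ex A) = all (neg A)
neg (all2 A) = ex2 (neg A)
neg (ex2 A) = all2 (neg A)

subF : ∀ {V b m n} → (Fin m → Tm n) → F V b m → F V b n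
subF σ (rel R ts) = rel R (Vec.map (subTm σ) ts)
subF σ (nrel R ts) = nrel R (Vec.map (subTm σ) ts)
subF σ (mem X t) = mem X (subTm σ t)
subF σ (nmem X t) = nmem X (subTm σ t)
subF σ (and A B) = and (subF σ A) (subF σ B)
subF σ (or A B) = or (subF σ A) (subF σ B)
subF σ (all A) = all (subF (liftSub σ) A)
subF σ (ex A) = ex (subF (liftSub σ) A)
subF σ (all2 A) = all2 (subF σ A)
subF σ (ex2 A) = ex2 (subF σ A)

inst : F ℕ true 1 → ℕ → Form
inst A k = subF (λ _ → num k) A

-- Abstraction T = λx.B with B(0) a formula: B has one number variable.
Abs : Set
Abs = F ℕ true 1

substX : ∀ {n} → F ⊤ false n → Abs → F ℕ true n
substX (rel R ts) T = rel R ts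
substX (nrel R ts) T = nrel R ts
substX (mem tt t) T = subF (λ _ → t) T
substX (nmem tt t) T = neg (subF (λ _ → t) T)
substX (and A B) T = and (substX A T) (substX B T)
substX (or A B) T = or (substX A T) (substX B T)
substX (all A) T = all (substX A T)
substX (ex A) T = ex (substX A T)

renX : F ⊤ false 0 → ℕ → Form
renX A Y = substX A (mem Y (var zero))

OccursF : ∀ {b n} → ℕ → F ℕ b n → Set
OccursF Y (rel R ts) = ⊥
OccursF Y (nrel R ts) = ⊥
OccursF Y (mem X t) = X ≡ Y
OccursF Y (nmem X t) = X ≡ Y
OccursF Y (and A B) = OccursF Y A ⊎ OccursF Y B
OccursF Y (or A B) = OccursF Y A ⊎ OccursF Y B
OccursF Y (all A) = OccursF Y A
OccursF Y (ex A) = OccursF Y A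
OccursF Y (all2 A) = ⊥
OccursF Y (ex2 A) = ⊥

OccursSeq : ℕ → Seq → Set
OccursSeq Y Γ = Σ Form λ A → A ∈ Γ × OccursF Y A

TRUE : Form → Set
TRUE (rel R ts) = Holds R (Vec.map evalTm ts)
TRUE (nrel R ts) = ¬ Holds R (Vec.map evalTm ts)
TRUE _ = ⊥

Pi1 : ∀ {V b n} → F V b n → Set
Pi1 (rel R ts) = ⊤
Pi1 (nrel R ts) = ⊤
Pi1 (mem X t) = ⊤
Pi1 (nmem X t) = ⊤
Pi1 (and A B) = Pi1 A × Pi1 B
Pi1 (or A B) = Pi1 A × Pi1 B
Pi1 (all A) = Pi1 A
Pi1 (ex A) = Pi1 A
Pi1 (all2 A) = Pi1 A
Pi1 (ex2 A) = ⊥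

Pi1Seq : Seq → Set
Pi1Seq Γ = All Pi1 Γ

-- Derivations of BI⁻.  Der Γ : derivations d with Γ(d) = Γ.
-- Each constructor records the principal formulas (Δ(I) ⊆ Γ) and, for each
-- premise i, a sequent Γᵢ = Γ(dᵢ) with Γᵢ ⊆ Δᵢ(I) ∪ Γ.

data Der (Γ : Seq) : Set where
  AxTrue : (A : Form) → TRUE A → A ∈ Γ → Der Γ
  AxLog  : (C : Form) → C ∈ Γ → neg C ∈ Γ → Der Γ
  AndI   : (A₀ A₁ : Form) → and A₀ A₁ ∈ Γ →
           (Γ₀ : Seq) → Γ₀ ⊆ A₀ ∷ Γ → Der Γ₀ →
           (Γ₁ : Seq) → Γ₁ ⊆ A₁ ∷ Γ → Der Γ₁ → Der Γ
  OrI₀   : (A₀ A₁ : Form) → or A₀ A₁ ∈ Γ →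
           (Γ₀ : Seq) → Γ₀ ⊆ A₀ ∷ Γ → Der Γ₀ → Der Γ
  OrI₁   : (A₀ A₁ : Form) → or A₀ A₁ ∈ Γ →
           (Γ₀ : Seq) → Γ₀ ⊆ A₁ ∷ Γ → Der Γ₀ → Der Γ
  AllI   : (A : F ℕ true 1) → all A ∈ Γ →
           (Γs : ℕ → Seq) → (∀ k → Γs k ⊆ inst A k ∷ Γ) →
           ((k : ℕ) → Der (Γs k)) → Der Γ
  ExI    : (A : F ℕ true 1) → ex A ∈ Γ → (k : ℕ) →
           (Γ₀ : Seq) → Γ₀ ⊆ inst A k ∷ Γ → Der Γ₀ → Der Γ
  All2I  : (A : F ⊤ false 0) → all2 A ∈ Γ →
           (Y : ℕ) → ¬ OccursSeq Y Γ →
           (Γ₀ : Seq) → Γ₀ ⊆ renX A Y ∷ Γ → Der Γ₀ → Der Γ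
  NAll2I : (A : F ⊤ false 0) → neg (all2 A) ∈ Γ → (T : Abs) →
           (Γ₀ : Seq) → Γ₀ ⊆ neg (substX A T) ∷ Γ → Der Γ₀ → Der Γ
  Cut    : (A : Form) →
           (Γ₀ : Seq) → Γ₀ ⊆ A ∷ Γ → Der Γ₀ →
           (Γ₁ : Seq) → Γ₁ ⊆ neg A ∷ Γ → Der Γ₁ → Der Γ

CutFree : ∀ {Γ} → Der Γ → Set
CutFree (AxTrue _ _ _) = ⊤
CutFree (AxLog _ _ _) = ⊤
CutFree (AndI _ _ _ _ _ d₀ _ _ d₁) = CutFree d₀ × CutFree d₁
CutFree (OrI₀ _ _ _ _ _ d) = CutFree d
CutFree (OrI₁ _ _ _ _ _ d) = CutFree d
CutFree (AllI _ _ _ _ ds) = ∀ k → CutFree (ds k)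
CutFree (ExI _ _ _ _ _ d) = CutFree d
CutFree (All2I _ _ _ _ _ _ d) = CutFree d
CutFree (NAll2I _ _ _ _ _ d) = CutFree d
CutFree (Cut _ _ _ _ _ _ _) = ⊥

-- Buchholz's Ω-rule.  A BI⁻-derivation is embedded into an infinitary system
-- in which the inference for ¬∀X A with witness T is replaced by the Ω-rule:
-- from a derivation of Δ, Γ for every cut-free derivation of ∀X A, Δ with Δ a
-- Π¹-sequent, infer ∃X¬A, Γ.  The witness T is recovered by inverting ∀X A,
-- substituting T for the eigenvariable and cutting against ¬A(X/T).  In this
-- system the usual inversions reduce every cut to one on a literal or on a
-- second-order quantifier.  A derivation of a Π¹-sequent Γ is then collapsed:
-- the premise ∀X A, Γ of a cut on ∀X A becomes a cut-free derivation, which is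
-- exactly what the Ω-inferences for ∃X¬A in the other premise ask for; literal
-- cuts are admissible in the cut-free calculus.

module Submission where

open import Defs
open import Data.Nat using (ℕ; zero; suc; _≤_; _⊔_; _≟_)
open import Data.Nat.Properties using (m≤m⊔n; m≤n⊔m; ≤-trans; n≮n; ≤-refl; ≤-pred; ≤-reflexive)
open import Data.Fin using (Fin; zero; suc)
open import Data.Vec.Properties using (map-cong; map-∘; map-id)
open import Data.Bool using (false; true)
open import Data.Unit using (⊤; tt)
open import Data.Empty using (⊥; ⊥-elim)
open import Data.Product using (Σ; _×_; _,_; proj₁; proj₂)
open import Data.Sum as Sum using (_⊎_; inj₁; inj₂; [_,_]′)
open import Data.List using (List; []; _∷_; _++_; map)
open import Data.List.Membership.Propositional using (_∈_)
open import Data.List.Membership.Propositional.Properties using (∈-map⁺; ∈-++⁺ˡ; ∈-++⁺ʳ; ∈-++⁻)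
open import Data.List.Relation.Unary.Any using (here; there)
open import Data.List.Relation.Unary.All as All using (All; []; _∷_)
open import Data.List.Relation.Binary.Subset.Propositional using (_⊆_)
open import Data.List.Relation.Binary.Subset.Propositional.Properties
  using (⊆-refl; ⊆-trans; ∷⁺ʳ; ∈-∷⁺ʳ; ++⁺ʳ; map⁺; ⊆-reflexive-↭)
import Data.List.Relation.Binary.Permutation.Propositional as ↭
open import Data.List.Relation.Binary.Permutation.Propositional.Properties using (shift; shifts)
open import Relation.Binary.PropositionalEquality
open import Relation.Nullary using (¬_; yes; no)
open import Function using (id; _∘_)

neg-involutive : ∀ {V b n} (A : F V b n) → neg (neg A) ≡ A
neg-involutive (rel R ts) = refl
neg-involutive (nrel R ts) = refl
neg-involutive (mem X t) = refl
neg-involutive (nmem X t) = refl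
neg-involutive (and A B) = cong₂ and (neg-involutive A) (neg-involutive B)
neg-involutive (or A B) = cong₂ or (neg-involutive A) (neg-involutive B)
neg-involutive (all A) = cong all (neg-involutive A)
neg-involutive (ex A) = cong ex (neg-involutive A)
neg-involutive (all2 A) = cong all2 (neg-involutive A)
neg-involutive (ex2 A) = cong ex2 (neg-involutive A)

neg-injective : ∀ {V b n} {A B : F V b n} → neg A ≡ neg B → A ≡ B
neg-injective {A = A} {B} eq = begin
  A             ≡⟨ neg-involutive A ⟨
  neg (neg A)   ≡⟨ cong neg eq ⟩
  neg (neg B)   ≡⟨ neg-involutive B ⟩
  B             ∎
  where open ≡-Reasoning

neg-irreflexive : ∀ {V b n} (A : F V b n) → neg A ≢ A
neg-irreflexive (rel R ts) ()
neg-irreflexive (nrel R ts) ()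
neg-irreflexive (mem X t) ()
neg-irreflexive (nmem X t) ()
neg-irreflexive (and A B) ()
neg-irreflexive (or A B) ()
neg-irreflexive (all A) ()
neg-irreflexive (ex A) ()
neg-irreflexive (all2 A) ()
neg-irreflexive (ex2 A) ()

neg-∈ : ∀ {C D : Form} {Γ : Seq} → neg C ≡ D → C ∈ Γ → neg D ∈ Γ
neg-∈ {C} eq = subst (_∈ _) (trans (sym (neg-involutive C)) (cong neg eq))

subTm-cong : ∀ {m n} {σ τ : Fin m → Tm n} → (∀ i → σ i ≡ τ i) → (t : Tm m) → subTm σ t ≡ subTm τ t
subTm-cong h (var i) = h i
subTm-cong h zer = refl
subTm-cong h (succ t) = cong succ (subTm-cong h t)

liftSub-cong : ∀ {m n} {σ τ : Fin m → Tm n} → (∀ i → σ i ≡ τ i) → ∀ i → liftSub σ i ≡ liftSub τ i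
liftSub-cong h zero = refl
liftSub-cong h (suc i) = cong (renTm suc) (h i)

subTm-renTm : ∀ {k m n} (σ : Fin m → Tm n) (ρ : Fin k → Fin m) (t : Tm k) →
              subTm σ (renTm ρ t) ≡ subTm (σ ∘ ρ) t
subTm-renTm σ ρ (var i) = refl
subTm-renTm σ ρ zer = refl
subTm-renTm σ ρ (succ t) = cong succ (subTm-renTm σ ρ t)

renTm-subTm : ∀ {k m n} (ρ : Fin m → Fin n) (σ : Fin k → Tm m) (t : Tm k) →
              renTm ρ (subTm σ t) ≡ subTm (renTm ρ ∘ σ) t
renTm-subTm ρ σ (var i) = refl
renTm-subTm ρ σ zer = refl
renTm-subTm ρ σ (succ t) = cong succ (renTm-subTm ρ σ t)

subTm-subTm : ∀ {k m n} (τ : Fin m → Tm n) (σ : Fin k → Tm m) (t : Tm k) →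
              subTm τ (subTm σ t) ≡ subTm (subTm τ ∘ σ) t
subTm-subTm τ σ (var i) = refl
subTm-subTm τ σ zer = refl
subTm-subTm τ σ (succ t) = cong succ (subTm-subTm τ σ t)

liftSub-subTm : ∀ {k m n} (τ : Fin m → Tm n) (σ : Fin k → Tm m) →
                ∀ i → subTm (liftSub τ) (liftSub σ i) ≡ liftSub (subTm τ ∘ σ) i
liftSub-subTm τ σ zero = refl
liftSub-subTm τ σ (suc j) = trans (subTm-renTm (liftSub τ) suc (σ j)) (sym (renTm-subTm suc τ (σ j)))

subTm-id : ∀ {m} {σ : Fin m → Tm m} → (∀ i → σ i ≡ var i) → (t : Tm m) → subTm σ t ≡ t
subTm-id h (var i) = h i
subTm-id h zer = refl
subTm-id h (succ t) = cong succ (subTm-id h t)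

liftSub-id : ∀ {m} {σ : Fin m → Tm m} → (∀ i → σ i ≡ var i) → ∀ i → liftSub σ i ≡ var i
liftSub-id h zero = refl
liftSub-id h (suc i) = cong (renTm suc) (h i)

subF-cong : ∀ {V b m n} {σ τ : Fin m → Tm n} → (∀ i → σ i ≡ τ i) → (A : F V b m) → subF σ A ≡ subF τ A
subF-cong h (rel R ts) = cong (rel R) (map-cong (subTm-cong h) ts)
subF-cong h (nrel R ts) = cong (nrel R) (map-cong (subTm-cong h) ts)
subF-cong h (mem X t) = cong (mem X) (subTm-cong h t)
subF-cong h (nmem X t) = cong (nmem X) (subTm-cong h t)
subF-cong h (and A B) = cong₂ and (subF-cong h A) (subF-cong h B)
subF-cong h (or A B) = cong₂ or (subF-cong h A) (subF-cong h B)
subF-cong h (all A) = cong all (subF-cong (liftSub-cong h) A)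
subF-cong h (ex A) = cong ex (subF-cong (liftSub-cong h) A)
subF-cong h (all2 A) = cong all2 (subF-cong h A)
subF-cong h (ex2 A) = cong ex2 (subF-cong h A)

subF-subF : ∀ {V b k m n} (τ : Fin m → Tm n) (σ : Fin k → Tm m) (A : F V b k) →
            subF τ (subF σ A) ≡ subF (subTm τ ∘ σ) A
subF-subF τ σ (rel R ts) =
  cong (rel R) (trans (sym (map-∘ (subTm τ) (subTm σ) ts)) (map-cong (subTm-subTm τ σ) ts))
subF-subF τ σ (nrel R ts) =
  cong (nrel R) (trans (sym (map-∘ (subTm τ) (subTm σ) ts)) (map-cong (subTm-subTm τ σ) ts))
subF-subF τ σ (mem X t) = cong (mem X) (subTm-subTm τ σ t)
subF-subF τ σ (nmem X t) = cong (nmem X) (subTm-subTm τ σ t)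
subF-subF τ σ (and A B) = cong₂ and (subF-subF τ σ A) (subF-subF τ σ B)
subF-subF τ σ (or A B) = cong₂ or (subF-subF τ σ A) (subF-subF τ σ B)
subF-subF τ σ (all A) = cong all (trans (subF-subF (liftSub τ) (liftSub σ) A) (subF-cong (liftSub-subTm τ σ) A))
subF-subF τ σ (ex A) = cong ex (trans (subF-subF (liftSub τ) (liftSub σ) A) (subF-cong (liftSub-subTm τ σ) A))
subF-subF τ σ (all2 A) = cong all2 (subF-subF τ σ A)
subF-subF τ σ (ex2 A) = cong ex2 (subF-subF τ σ A)

subF-id : ∀ {V b m} {σ : Fin m → Tm m} → (∀ i → σ i ≡ var i) → (A : F V b m) → subF σ A ≡ A
subF-id h (rel R ts) = cong (rel R) (trans (map-cong (subTm-id h) ts) (map-id ts))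
subF-id h (nrel R ts) = cong (nrel R) (trans (map-cong (subTm-id h) ts) (map-id ts))
subF-id h (mem X t) = cong (mem X) (subTm-id h t)
subF-id h (nmem X t) = cong (nmem X) (subTm-id h t)
subF-id h (and A B) = cong₂ and (subF-id h A) (subF-id h B)
subF-id h (or A B) = cong₂ or (subF-id h A) (subF-id h B)
subF-id h (all A) = cong all (subF-id (liftSub-id h) A)
subF-id h (ex A) = cong ex (subF-id (liftSub-id h) A)
subF-id h (all2 A) = cong all2 (subF-id h A)
subF-id h (ex2 A) = cong ex2 (subF-id h A)

subF-neg : ∀ {V b m n} (σ : Fin m → Tm n) (A : F V b m) → subF σ (neg A) ≡ neg (subF σ A)
subF-neg σ (rel R ts) = refl
subF-neg σ (nrel R ts) = refl
subF-neg σ (mem X t) = refl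
subF-neg σ (nmem X t) = refl
subF-neg σ (and A B) = cong₂ or (subF-neg σ A) (subF-neg σ B)
subF-neg σ (or A B) = cong₂ and (subF-neg σ A) (subF-neg σ B)
subF-neg σ (all A) = cong ex (subF-neg (liftSub σ) A)
subF-neg σ (ex A) = cong all (subF-neg (liftSub σ) A)
subF-neg σ (all2 A) = cong ex2 (subF-neg σ A)
subF-neg σ (ex2 A) = cong all2 (subF-neg σ A)

inst-neg : (A : F ℕ true 1) (k : ℕ) → inst (neg A) k ≡ neg (inst A k)
inst-neg A k = subF-neg _ A

-- Second-order quantified formulas have rank 0: cuts on them are handled by the Ω-rule.
rank : ∀ {V b n} → F V b n → ℕ
rank (and A B) = suc (rank A ⊔ rank B)
rank (or A B) = suc (rank A ⊔ rank B)
rank (all A) = suc (rank A)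
rank (ex A) = suc (rank A)
rank _ = 0

rank-subF : ∀ {V b m n} (σ : Fin m → Tm n) (A : F V b m) → rank (subF σ A) ≡ rank A
rank-subF σ (rel R ts) = refl
rank-subF σ (nrel R ts) = refl
rank-subF σ (mem X t) = refl
rank-subF σ (nmem X t) = refl
rank-subF σ (and A B) = cong₂ (λ a b → suc (a ⊔ b)) (rank-subF σ A) (rank-subF σ B)
rank-subF σ (or A B) = cong₂ (λ a b → suc (a ⊔ b)) (rank-subF σ A) (rank-subF σ B)
rank-subF σ (all A) = cong suc (rank-subF (liftSub σ) A)
rank-subF σ (ex A) = cong suc (rank-subF (liftSub σ) A)
rank-subF σ (all2 A) = refl
rank-subF σ (ex2 A) = refl

SetSub : Set
SetSub = ℕ → Abs

substSet : ∀ {n} → SetSub → F ℕ true n → F ℕ true n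
substSet σ (rel R ts) = rel R ts
substSet σ (nrel R ts) = nrel R ts
substSet σ (mem X t) = subF (λ _ → t) (σ X)
substSet σ (nmem X t) = neg (subF (λ _ → t) (σ X))
substSet σ (and A B) = and (substSet σ A) (substSet σ B)
substSet σ (or A B) = or (substSet σ A) (substSet σ B)
substSet σ (all A) = all (substSet σ A)
substSet σ (ex A) = ex (substSet σ A)
substSet σ (all2 A) = all2 A
substSet σ (ex2 A) = ex2 A

substSetSeq : SetSub → Seq → Seq
substSetSeq σ = map (substSet σ)

substSet-neg : ∀ {n} (σ : SetSub) (A : F ℕ true n) → substSet σ (neg A) ≡ neg (substSet σ A)
substSet-neg σ (rel R ts) = refl
substSet-neg σ (nrel R ts) = refl
substSet-neg σ (mem X t) = refl
substSet-neg σ (nmem X t) = sym (neg-involutive _)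
substSet-neg σ (and A B) = cong₂ or (substSet-neg σ A) (substSet-neg σ B)
substSet-neg σ (or A B) = cong₂ and (substSet-neg σ A) (substSet-neg σ B)
substSet-neg σ (all A) = cong ex (substSet-neg σ A)
substSet-neg σ (ex A) = cong all (substSet-neg σ A)
substSet-neg σ (all2 A) = refl
substSet-neg σ (ex2 A) = refl

substSet-subF : ∀ {m n} (σ : SetSub) (τ : Fin m → Tm n) (A : F ℕ true m) →
                substSet σ (subF τ A) ≡ subF τ (substSet σ A)
substSet-subF σ τ (rel R ts) = refl
substSet-subF σ τ (nrel R ts) = refl
substSet-subF σ τ (mem X t) = sym (subF-subF τ (λ _ → t) (σ X))
substSet-subF σ τ (nmem X t) =
  sym (trans (subF-neg τ (subF (λ _ → t) (σ X))) (cong neg (subF-subF τ (λ _ → t) (σ X))))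
substSet-subF σ τ (and A B) = cong₂ and (substSet-subF σ τ A) (substSet-subF σ τ B)
substSet-subF σ τ (or A B) = cong₂ or (substSet-subF σ τ A) (substSet-subF σ τ B)
substSet-subF σ τ (all A) = cong all (substSet-subF σ (liftSub τ) A)
substSet-subF σ τ (ex A) = cong ex (substSet-subF σ (liftSub τ) A)
substSet-subF σ τ (all2 A) = refl
substSet-subF σ τ (ex2 A) = refl

substSet-inst : (σ : SetSub) (A : F ℕ true 1) (k : ℕ) → substSet σ (inst A k) ≡ inst (substSet σ A) k
substSet-inst σ A k = substSet-subF σ (λ _ → num k) A

substSet-substX : ∀ {n} (σ : SetSub) (A : F ⊤ false n) (T : Abs) →
                  substSet σ (substX A T) ≡ substX A (substSet σ T)
substSet-substX σ (rel R ts) T = refl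
substSet-substX σ (nrel R ts) T = refl
substSet-substX σ (mem tt t) T = substSet-subF σ (λ _ → t) T
substSet-substX σ (nmem tt t) T =
  trans (substSet-neg σ (subF (λ _ → t) T)) (cong neg (substSet-subF σ (λ _ → t) T))
substSet-substX σ (and A B) T = cong₂ and (substSet-substX σ A T) (substSet-substX σ B T)
substSet-substX σ (or A B) T = cong₂ or (substSet-substX σ A T) (substSet-substX σ B T)
substSet-substX σ (all A) T = cong all (substSet-substX σ A T)
substSet-substX σ (ex A) T = cong ex (substSet-substX σ A T)

varAbs : ℕ → Abs
varAbs Y = mem Y (var zero)

substSet-renX : (σ : SetSub) (A : F ⊤ false 0) (Y : ℕ) → substSet σ (renX A Y) ≡ substX A (σ Y)
substSet-renX σ A Y =
  trans (substSet-substX σ A (varAbs Y)) (cong (substX A) (subF-id (λ { zero → refl }) (σ Y)))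

substSet-id : ∀ {n} (A : F ℕ true n) → substSet varAbs A ≡ A
substSet-id (rel R ts) = refl
substSet-id (nrel R ts) = refl
substSet-id (mem X t) = refl
substSet-id (nmem X t) = refl
substSet-id (and A B) = cong₂ and (substSet-id A) (substSet-id B)
substSet-id (or A B) = cong₂ or (substSet-id A) (substSet-id B)
substSet-id (all A) = cong all (substSet-id A)
substSet-id (ex A) = cong ex (substSet-id A)
substSet-id (all2 A) = refl
substSet-id (ex2 A) = refl

substSetSeq-id : (Γ : Seq) → substSetSeq varAbs Γ ≡ Γ
substSetSeq-id [] = refl
substSetSeq-id (A ∷ Γ) = cong₂ _∷_ (substSet-id A) (substSetSeq-id Γ)

substSet-cong : ∀ {n} {σ τ : SetSub} (A : F ℕ true n) →
                (∀ Y → OccursF Y A → σ Y ≡ τ Y) → substSet σ A ≡ substSet τ A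
substSet-cong (rel R ts) h = refl
substSet-cong (nrel R ts) h = refl
substSet-cong (mem X t) h = cong (subF (λ _ → t)) (h X refl)
substSet-cong (nmem X t) h = cong (neg ∘ subF (λ _ → t)) (h X refl)
substSet-cong (and A B) h = cong₂ and (substSet-cong A (λ Y → h Y ∘ inj₁)) (substSet-cong B (λ Y → h Y ∘ inj₂))
substSet-cong (or A B) h = cong₂ or (substSet-cong A (λ Y → h Y ∘ inj₁)) (substSet-cong B (λ Y → h Y ∘ inj₂))
substSet-cong (all A) h = cong all (substSet-cong A h)
substSet-cong (ex A) h = cong ex (substSet-cong A h)
substSet-cong (all2 A) h = refl
substSet-cong (ex2 A) h = refl

_[_≔_] : SetSub → ℕ → Abs → SetSub
(σ [ Y ≔ T ]) W with W ≟ Y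
... | yes _ = T
... | no _ = σ W

update-same : ∀ σ Y T → (σ [ Y ≔ T ]) Y ≡ T
update-same σ Y T with Y ≟ Y
... | yes _ = refl
... | no Y≢Y = ⊥-elim (Y≢Y refl)

update-other : ∀ σ Y T W → W ≢ Y → (σ [ Y ≔ T ]) W ≡ σ W
update-other σ Y T W W≢Y with W ≟ Y
... | yes W≡Y = ⊥-elim (W≢Y W≡Y)
... | no _ = refl

substSetSeq-update : ∀ σ Y T (Γ : Seq) → ¬ OccursSeq Y Γ → substSetSeq (σ [ Y ≔ T ]) Γ ≡ substSetSeq σ Γ
substSetSeq-update σ Y T [] _ = refl
substSetSeq-update σ Y T (A ∷ Γ) Y∉ =
  cong₂ _∷_ (substSet-cong A (λ W o → update-other σ Y T W (λ { refl → Y∉ (A , here refl , o) })))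
            (substSetSeq-update σ Y T Γ (λ { (B , p , o) → Y∉ (B , there p , o) }))

maxSetVar : ∀ {b n} → F ℕ b n → ℕ
maxSetVar (mem X t) = X
maxSetVar (nmem X t) = X
maxSetVar (and A B) = maxSetVar A ⊔ maxSetVar B
maxSetVar (or A B) = maxSetVar A ⊔ maxSetVar B
maxSetVar (all A) = maxSetVar A
maxSetVar (ex A) = maxSetVar A
maxSetVar _ = 0

occurs⇒≤maxSetVar : ∀ {b n} Y (A : F ℕ b n) → OccursF Y A → Y ≤ maxSetVar A
occurs⇒≤maxSetVar Y (mem X t) refl = ≤-refl
occurs⇒≤maxSetVar Y (nmem X t) refl = ≤-refl
occurs⇒≤maxSetVar Y (and A B) (inj₁ o) = ≤-trans (occurs⇒≤maxSetVar Y A o) (m≤m⊔n _ _)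
occurs⇒≤maxSetVar Y (and A B) (inj₂ o) = ≤-trans (occurs⇒≤maxSetVar Y B o) (m≤n⊔m _ _)
occurs⇒≤maxSetVar Y (or A B) (inj₁ o) = ≤-trans (occurs⇒≤maxSetVar Y A o) (m≤m⊔n _ _)
occurs⇒≤maxSetVar Y (or A B) (inj₂ o) = ≤-trans (occurs⇒≤maxSetVar Y B o) (m≤n⊔m _ _)
occurs⇒≤maxSetVar Y (all A) o = occurs⇒≤maxSetVar Y A o
occurs⇒≤maxSetVar Y (ex A) o = occurs⇒≤maxSetVar Y A o

maxSetVarSeq : Seq → ℕ
maxSetVarSeq [] = 0
maxSetVarSeq (A ∷ Γ) = maxSetVar A ⊔ maxSetVarSeq Γ

∈⇒maxSetVar≤ : ∀ {A} (Γ : Seq) → A ∈ Γ → maxSetVar A ≤ maxSetVarSeq Γ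
∈⇒maxSetVar≤ (B ∷ Γ) (here refl) = m≤m⊔n _ _
∈⇒maxSetVar≤ (B ∷ Γ) (there p) = ≤-trans (∈⇒maxSetVar≤ Γ p) (m≤n⊔m _ _)

fresh : Seq → ℕ
fresh Γ = suc (maxSetVarSeq Γ)

fresh-notOccurs : (Γ : Seq) → ¬ OccursSeq (fresh Γ) Γ
fresh-notOccurs Γ (A , p , o) = n≮n _ (≤-trans (occurs⇒≤maxSetVar (fresh Γ) A o) (∈⇒maxSetVar≤ Γ p))

Pi1-secondOrderFree : ∀ {V n} (A : F V false n) → Pi1 A
Pi1-secondOrderFree (rel R ts) = tt
Pi1-secondOrderFree (nrel R ts) = tt
Pi1-secondOrderFree (mem X t) = tt
Pi1-secondOrderFree (nmem X t) = tt
Pi1-secondOrderFree (and A B) = Pi1-secondOrderFree A , Pi1-secondOrderFree B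
Pi1-secondOrderFree (or A B) = Pi1-secondOrderFree A , Pi1-secondOrderFree B
Pi1-secondOrderFree (all A) = Pi1-secondOrderFree A
Pi1-secondOrderFree (ex A) = Pi1-secondOrderFree A

Pi1-subF : ∀ {V b m n} (σ : Fin m → Tm n) (A : F V b m) → Pi1 A → Pi1 (subF σ A)
Pi1-subF σ (rel R ts) p = tt
Pi1-subF σ (nrel R ts) p = tt
Pi1-subF σ (mem X t) p = tt
Pi1-subF σ (nmem X t) p = tt
Pi1-subF σ (and A B) (p , q) = Pi1-subF σ A p , Pi1-subF σ B q
Pi1-subF σ (or A B) (p , q) = Pi1-subF σ A p , Pi1-subF σ B q
Pi1-subF σ (all A) p = Pi1-subF (liftSub σ) A p
Pi1-subF σ (ex A) p = Pi1-subF (liftSub σ) A p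
Pi1-subF σ (all2 A) p = Pi1-subF σ A p

Pi1-substX-varAbs : ∀ {n} (A : F ⊤ false n) Y → Pi1 (substX A (varAbs Y))
Pi1-substX-varAbs (rel R ts) Y = tt
Pi1-substX-varAbs (nrel R ts) Y = tt
Pi1-substX-varAbs (mem tt t) Y = tt
Pi1-substX-varAbs (nmem tt t) Y = tt
Pi1-substX-varAbs (and A B) Y = Pi1-substX-varAbs A Y , Pi1-substX-varAbs B Y
Pi1-substX-varAbs (or A B) Y = Pi1-substX-varAbs A Y , Pi1-substX-varAbs B Y
Pi1-substX-varAbs (all A) Y = Pi1-substX-varAbs A Y
Pi1-substX-varAbs (ex A) Y = Pi1-substX-varAbs A Y

data Literal : Form → Set where
  rel  : ∀ R ts → Literal (rel R ts)
  nrel : ∀ R ts → Literal (nrel R ts)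
  mem  : ∀ X t → Literal (mem X t)
  nmem : ∀ X t → Literal (nmem X t)

Literal-neg : ∀ {L} → Literal L → Literal (neg L)
Literal-neg (rel R ts) = nrel R ts
Literal-neg (nrel R ts) = rel R ts
Literal-neg (mem X t) = nmem X t
Literal-neg (nmem X t) = mem X t

Literal-Pi1 : ∀ {L} → Literal L → Pi1 L
Literal-Pi1 (rel R ts) = tt
Literal-Pi1 (nrel R ts) = tt
Literal-Pi1 (mem X t) = tt
Literal-Pi1 (nmem X t) = tt

TRUE-neg : ∀ {L} → Literal L → TRUE L → ¬ TRUE (neg L)
TRUE-neg (rel R ts) holds fails = fails holds
TRUE-neg (nrel R ts) fails holds = fails holds

∷-swap : ∀ {A B : Form} {Γ : Seq} → A ∷ B ∷ Γ ⊆ B ∷ A ∷ Γ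
∷-swap = ⊆-reflexive-↭ (↭.swap _ _ ↭.refl)

∷-contract : ∀ {A : Form} {Γ : Seq} → A ∷ A ∷ Γ ⊆ A ∷ Γ
∷-contract = ∈-∷⁺ʳ (here refl) ⊆-refl

⊆∷-extend : ∀ {Θ Out : Seq} {D A} → Θ ⊆ D ∷ Out → A ∷ Θ ⊆ D ∷ A ∷ Out
⊆∷-extend s = ⊆-trans (∷⁺ʳ _ s) ∷-swap

-- Cut-free derivations

-- Premises extend the conclusion by exactly the minor formula, and the
-- ∀X-rule has a premise for every set variable, so no eigenvariable
-- condition is needed.
data CutFreeDer (Γ : Seq) : Set where
  axTrue : ∀ A → TRUE A → A ∈ Γ → CutFreeDer Γ
  axLog  : ∀ C → C ∈ Γ → neg C ∈ Γ → CutFreeDer Γ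
  andI   : ∀ A B → and A B ∈ Γ → CutFreeDer (A ∷ Γ) → CutFreeDer (B ∷ Γ) → CutFreeDer Γ
  orI₀   : ∀ A B → or A B ∈ Γ → CutFreeDer (A ∷ Γ) → CutFreeDer Γ
  orI₁   : ∀ A B → or A B ∈ Γ → CutFreeDer (B ∷ Γ) → CutFreeDer Γ
  allI   : ∀ A → all A ∈ Γ → (∀ k → CutFreeDer (inst A k ∷ Γ)) → CutFreeDer Γ
  exI    : ∀ A → ex A ∈ Γ → ∀ k → CutFreeDer (inst A k ∷ Γ) → CutFreeDer Γ
  all2I  : ∀ A → all2 A ∈ Γ → (∀ Y → CutFreeDer (renX A Y ∷ Γ)) → CutFreeDer Γ

CutFreeDer-weaken : ∀ {Γ Δ} → Γ ⊆ Δ → CutFreeDer Γ → CutFreeDer Δ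
CutFreeDer-weaken s (axTrue A t p) = axTrue A t (s p)
CutFreeDer-weaken s (axLog C p q) = axLog C (s p) (s q)
CutFreeDer-weaken s (andI A B p d₀ d₁) =
  andI A B (s p) (CutFreeDer-weaken (∷⁺ʳ _ s) d₀) (CutFreeDer-weaken (∷⁺ʳ _ s) d₁)
CutFreeDer-weaken s (orI₀ A B p d) = orI₀ A B (s p) (CutFreeDer-weaken (∷⁺ʳ _ s) d)
CutFreeDer-weaken s (orI₁ A B p d) = orI₁ A B (s p) (CutFreeDer-weaken (∷⁺ʳ _ s) d)
CutFreeDer-weaken s (allI A p ds) = allI A (s p) (λ k → CutFreeDer-weaken (∷⁺ʳ _ s) (ds k))
CutFreeDer-weaken s (exI A p k d) = exI A (s p) k (CutFreeDer-weaken (∷⁺ʳ _ s) d)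
CutFreeDer-weaken s (all2I A p ds) = all2I A (s p) (λ Y → CutFreeDer-weaken (∷⁺ʳ _ s) (ds Y))

toCutFree : ∀ {Γ} → CutFreeDer Γ → Σ (Der Γ) CutFree
toCutFree (axTrue A t p) = AxTrue A t p , tt
toCutFree (axLog C p q) = AxLog C p q , tt
toCutFree (andI A B p d₀ d₁) =
  AndI A B p _ id (proj₁ (toCutFree d₀)) _ id (proj₁ (toCutFree d₁)) ,
  proj₂ (toCutFree d₀) , proj₂ (toCutFree d₁)
toCutFree (orI₀ A B p d) = OrI₀ A B p _ id (proj₁ (toCutFree d)) , proj₂ (toCutFree d)
toCutFree (orI₁ A B p d) = OrI₁ A B p _ id (proj₁ (toCutFree d)) , proj₂ (toCutFree d)
toCutFree (allI A p ds) = AllI A p _ (λ _ → id) (proj₁ ∘ toCutFree ∘ ds) , proj₂ ∘ toCutFree ∘ ds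
toCutFree (exI A p k d) = ExI A p k _ id (proj₁ (toCutFree d)) , proj₂ (toCutFree d)
toCutFree {Γ} (all2I A p ds) =
  All2I A p Y (fresh-notOccurs Γ) _ id (proj₁ (toCutFree (ds Y))) , proj₂ (toCutFree (ds Y))
  where Y = fresh Γ

CutFreeDer-substSet : ∀ {Γ} (σ : SetSub) → CutFreeDer Γ → CutFreeDer (substSetSeq σ Γ)
CutFreeDer-substSet σ (axTrue (rel R ts) t p) = axTrue (rel R ts) t (∈-map⁺ (substSet σ) p)
CutFreeDer-substSet σ (axTrue (nrel R ts) t p) = axTrue (nrel R ts) t (∈-map⁺ (substSet σ) p)
CutFreeDer-substSet σ (axLog C p q) =
  axLog (substSet σ C) (∈-map⁺ (substSet σ) p) (subst (_∈ _) (substSet-neg σ C) (∈-map⁺ (substSet σ) q))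
CutFreeDer-substSet σ (andI A B p d₀ d₁) =
  andI (substSet σ A) (substSet σ B) (∈-map⁺ (substSet σ) p)
    (CutFreeDer-substSet σ d₀) (CutFreeDer-substSet σ d₁)
CutFreeDer-substSet σ (orI₀ A B p d) =
  orI₀ (substSet σ A) (substSet σ B) (∈-map⁺ (substSet σ) p) (CutFreeDer-substSet σ d)
CutFreeDer-substSet σ (orI₁ A B p d) =
  orI₁ (substSet σ A) (substSet σ B) (∈-map⁺ (substSet σ) p) (CutFreeDer-substSet σ d)
CutFreeDer-substSet σ (allI A p ds) = allI (substSet σ A) (∈-map⁺ (substSet σ) p) λ k →
  subst (λ B → CutFreeDer (B ∷ _)) (substSet-inst σ A k) (CutFreeDer-substSet σ (ds k))
CutFreeDer-substSet σ (exI A p k d) = exI (substSet σ A) (∈-map⁺ (substSet σ) p) k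
  (subst (λ B → CutFreeDer (B ∷ _)) (substSet-inst σ A k) (CutFreeDer-substSet σ d))
-- The premise for Z is obtained from the premise for a fresh Y by substituting Z for Y.
CutFreeDer-substSet {Γ} σ (all2I A p ds) = all2I A (∈-map⁺ (substSet σ) p) λ Z →
  subst₂ (λ B Δ → CutFreeDer (B ∷ Δ))
    (trans (substSet-renX (σ [ Y ≔ varAbs Z ]) A Y) (cong (substX A) (update-same σ Y (varAbs Z))))
    (substSetSeq-update σ Y (varAbs Z) Γ (fresh-notOccurs Γ))
    (CutFreeDer-substSet (σ [ Y ≔ varAbs Z ]) (ds Y))
  where Y = fresh Γ

all2-inversion : ∀ {Θ Out} A Y → Pi1Seq Out → Θ ⊆ all2 A ∷ Out → CutFreeDer Θ → CutFreeDer (renX A Y ∷ Out)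
all2-inversion-∷ : ∀ {Θ Out B} A Y → Pi1Seq Out → Pi1 B → Θ ⊆ all2 A ∷ Out →
                   CutFreeDer (B ∷ Θ) → CutFreeDer (B ∷ renX A Y ∷ Out)

all2-inversion A Y π s (axTrue B t p) with s p
... | here refl = ⊥-elim t
... | there q = axTrue B t (there q)
all2-inversion A Y π s (axLog C p q) with s p | s q
... | here refl | here ()
... | here refl | there q′ = ⊥-elim (All.lookup π q′)
... | there p′ | here e = ⊥-elim (All.lookup π (neg-∈ e p′))
... | there p′ | there q′ = axLog C (there p′) (there q′)
all2-inversion A Y π s (andI B C p d₀ d₁) with s p
... | there q = andI B C (there q) (all2-inversion-∷ A Y π (proj₁ (All.lookup π q)) s d₀)
                                  (all2-inversion-∷ A Y π (proj₂ (All.lookup π q)) s d₁)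
all2-inversion A Y π s (orI₀ B C p d) with s p
... | there q = orI₀ B C (there q) (all2-inversion-∷ A Y π (proj₁ (All.lookup π q)) s d)
all2-inversion A Y π s (orI₁ B C p d) with s p
... | there q = orI₁ B C (there q) (all2-inversion-∷ A Y π (proj₂ (All.lookup π q)) s d)
all2-inversion A Y π s (allI B p ds) with s p
... | there q = allI B (there q) λ k → all2-inversion-∷ A Y π (Pi1-subF _ B (All.lookup π q)) s (ds k)
all2-inversion A Y π s (exI B p k d) with s p
... | there q = exI B (there q) k (all2-inversion-∷ A Y π (Pi1-subF _ B (All.lookup π q)) s d)
all2-inversion A Y π s (all2I B p ds) with s p
... | here refl = CutFreeDer-weaken ∷-contract (all2-inversion-∷ A Y π (Pi1-substX-varAbs A Y) s (ds Y))
... | there q = all2I B (there q) λ Z → all2-inversion-∷ A Y π (Pi1-substX-varAbs B Z) s (ds Z)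

all2-inversion-∷ A Y π πB s d = CutFreeDer-weaken ∷-swap (all2-inversion A Y (πB ∷ π) (⊆∷-extend s) d)

all2-instantiate : ∀ {Δ} A T → Pi1Seq Δ → CutFreeDer (all2 A ∷ Δ) → CutFreeDer (substX A T ∷ Δ)
all2-instantiate {Δ} A T π d =
  subst₂ (λ B Γ → CutFreeDer (B ∷ Γ))
    (trans (substSet-renX (varAbs [ Y ≔ T ]) A Y) (cong (substX A) (update-same varAbs Y T)))
    (trans (substSetSeq-update varAbs Y T Δ (fresh-notOccurs Δ)) (substSetSeq-id Δ))
    (CutFreeDer-substSet (varAbs [ Y ≔ T ]) (all2-inversion A Y π ⊆-refl d))
  where Y = fresh Δ

-- How the axioms of a derivation are repaired once the literal M is deleted
-- from its end-sequent.
AxiomRepair : Form → Seq → Set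
AxiomRepair M Out = ∀ {O} → Out ⊆ O → neg M ∈ O ⊎ TRUE M → CutFreeDer O

AxiomRepair-∷ : ∀ {M Out A} → AxiomRepair M Out → AxiomRepair M (A ∷ Out)
AxiomRepair-∷ h s = h (s ∘ there)

removeLiteral : ∀ {Θ Out M} → Literal M → Θ ⊆ M ∷ Out → AxiomRepair M Out → CutFreeDer Θ → CutFreeDer Out
removeLiteral-∷ : ∀ {Θ Out M A} → Literal M → Θ ⊆ M ∷ Out → AxiomRepair M Out →
                  CutFreeDer (A ∷ Θ) → CutFreeDer (A ∷ Out)

removeLiteral l s h (axTrue B t p) with s p
... | here refl = h ⊆-refl (inj₂ t)
... | there q = axTrue B t q
removeLiteral l s h (axLog C p q) with s p | s q
... | here refl | here e = ⊥-elim (neg-irreflexive C e)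
... | here refl | there q′ = h ⊆-refl (inj₁ q′)
... | there p′ | here e = h ⊆-refl (inj₁ (neg-∈ e p′))
... | there p′ | there q′ = axLog C p′ q′
removeLiteral l s h (andI B C p d₀ d₁) with s p
... | here refl with () ← l
... | there q = andI B C q (removeLiteral-∷ l s h d₀) (removeLiteral-∷ l s h d₁)
removeLiteral l s h (orI₀ B C p d) with s p
... | here refl with () ← l
... | there q = orI₀ B C q (removeLiteral-∷ l s h d)
removeLiteral l s h (orI₁ B C p d) with s p
... | here refl with () ← l
... | there q = orI₁ B C q (removeLiteral-∷ l s h d)
removeLiteral l s h (allI B p ds) with s p
... | here refl with () ← l
... | there q = allI B q (λ k → removeLiteral-∷ l s h (ds k))
removeLiteral l s h (exI B p k d) with s p
... | here refl with () ← l
... | there q = exI B q k (removeLiteral-∷ l s h d)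
removeLiteral l s h (all2I B p ds) with s p
... | here refl with () ← l
... | there q = all2I B q (λ Y → removeLiteral-∷ l s h (ds Y))

removeLiteral-∷ l s h = removeLiteral l (⊆∷-extend s) (AxiomRepair-∷ h)

literal-cut : ∀ {L O} → Literal L → CutFreeDer (L ∷ O) → CutFreeDer (neg L ∷ O) → CutFreeDer O
literal-cut {L} {O} l d₀ d₁ = removeLiteral (Literal-neg l) ⊆-refl repair d₁
  where
  repair : AxiomRepair (neg L) O
  repair s (inj₁ p) = CutFreeDer-weaken (∈-∷⁺ʳ (subst (_∈ _) (neg-involutive L) p) s) d₀
  repair s (inj₂ t) = CutFreeDer-weaken s (removeLiteral l ⊆-refl repair′ d₀)
    where
    repair′ : AxiomRepair L O
    repair′ s′ (inj₁ q) = axTrue (neg L) t q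
    repair′ s′ (inj₂ t′) = ⊥-elim (TRUE-neg l t′ t)

-- Derivations with the Ω-rule

data Rank0 : Form → Set where
  literal : ∀ {L} → Literal L → Rank0 L
  all2    : ∀ A → Rank0 (all2 A)
  ex2     : ∀ A → Rank0 (ex2 A)

data ΩDer (Γ : Seq) : Set where
  axTrue : ∀ A → TRUE A → A ∈ Γ → ΩDer Γ
  axLog  : ∀ C → C ∈ Γ → neg C ∈ Γ → ΩDer Γ
  andI   : ∀ A B → and A B ∈ Γ → ΩDer (A ∷ Γ) → ΩDer (B ∷ Γ) → ΩDer Γ
  orI₀   : ∀ A B → or A B ∈ Γ → ΩDer (A ∷ Γ) → ΩDer Γ
  orI₁   : ∀ A B → or A B ∈ Γ → ΩDer (B ∷ Γ) → ΩDer Γ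
  allI   : ∀ A → all A ∈ Γ → (∀ k → ΩDer (inst A k ∷ Γ)) → ΩDer Γ
  exI    : ∀ A → ex A ∈ Γ → ∀ k → ΩDer (inst A k ∷ Γ) → ΩDer Γ
  all2I  : ∀ A → all2 A ∈ Γ → (∀ Y → ΩDer (renX A Y ∷ Γ)) → ΩDer Γ
  Ω      : ∀ A → ex2 (neg A) ∈ Γ →
           ((Δ : Seq) → Pi1Seq Δ → CutFreeDer (all2 A ∷ Δ) → ΩDer (Δ ++ Γ)) → ΩDer Γ
  cut₀   : ∀ C → Rank0 C → ΩDer (C ∷ Γ) → ΩDer (neg C ∷ Γ) → ΩDer Γ

ΩDer-weaken : ∀ {Γ Δ} → Γ ⊆ Δ → ΩDer Γ → ΩDer Δ
ΩDer-weaken s (axTrue A t p) = axTrue A t (s p)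
ΩDer-weaken s (axLog C p q) = axLog C (s p) (s q)
ΩDer-weaken s (andI A B p d₀ d₁) = andI A B (s p) (ΩDer-weaken (∷⁺ʳ _ s) d₀) (ΩDer-weaken (∷⁺ʳ _ s) d₁)
ΩDer-weaken s (orI₀ A B p d) = orI₀ A B (s p) (ΩDer-weaken (∷⁺ʳ _ s) d)
ΩDer-weaken s (orI₁ A B p d) = orI₁ A B (s p) (ΩDer-weaken (∷⁺ʳ _ s) d)
ΩDer-weaken s (allI A p ds) = allI A (s p) (λ k → ΩDer-weaken (∷⁺ʳ _ s) (ds k))
ΩDer-weaken s (exI A p k d) = exI A (s p) k (ΩDer-weaken (∷⁺ʳ _ s) d)
ΩDer-weaken s (all2I A p ds) = all2I A (s p) (λ Y → ΩDer-weaken (∷⁺ʳ _ s) (ds Y))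
ΩDer-weaken s (Ω A p ds) = Ω A (s p) (λ Δ π d → ΩDer-weaken (++⁺ʳ Δ s) (ds Δ π d))
ΩDer-weaken s (cut₀ C r d₀ d₁) = cut₀ C r (ΩDer-weaken (∷⁺ʳ _ s) d₀) (ΩDer-weaken (∷⁺ʳ _ s) d₁)

fromCutFree : ∀ {Γ} → CutFreeDer Γ → ΩDer Γ
fromCutFree (axTrue A t p) = axTrue A t p
fromCutFree (axLog C p q) = axLog C p q
fromCutFree (andI A B p d₀ d₁) = andI A B p (fromCutFree d₀) (fromCutFree d₁)
fromCutFree (orI₀ A B p d) = orI₀ A B p (fromCutFree d)
fromCutFree (orI₁ A B p d) = orI₁ A B p (fromCutFree d)
fromCutFree (allI A p ds) = allI A p (fromCutFree ∘ ds)
fromCutFree (exI A p k d) = exI A p k (fromCutFree d)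
fromCutFree (all2I A p ds) = all2I A p (fromCutFree ∘ ds)

-- An inference with principal formula D whose premises have already had D
-- removed and R added.
data Principal (R O : Seq) : Form → Set where
  axLog  : ∀ {D} → neg D ∈ O → Principal R O D
  axRel  : ∀ {P ts} → TRUE (rel P ts) → Principal R O (rel P ts)
  axNrel : ∀ {P ts} → TRUE (nrel P ts) → Principal R O (nrel P ts)
  andI   : ∀ {A B} → ΩDer (R ++ A ∷ O) → ΩDer (R ++ B ∷ O) → Principal R O (and A B)
  orI₀   : ∀ {A B} → ΩDer (R ++ A ∷ O) → Principal R O (or A B)
  orI₁   : ∀ {A B} → ΩDer (R ++ B ∷ O) → Principal R O (or A B)
  allI   : ∀ {A} → (∀ k → ΩDer (R ++ inst A k ∷ O)) → Principal R O (all A)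
  exI    : ∀ {A} k → ΩDer (R ++ inst A k ∷ O) → Principal R O (ex A)
  all2I  : ∀ {A} → (∀ Y → ΩDer (R ++ renX A Y ∷ O)) → Principal R O (all2 A)
  Ω      : ∀ {A} → ((Δ : Seq) → Pi1Seq Δ → CutFreeDer (all2 A ∷ Δ) → ΩDer (R ++ Δ ++ O)) →
           Principal R O (ex2 (neg A))

principal-TRUE : ∀ {R O} A → TRUE A → Principal R O A
principal-TRUE (rel _ _) t = axRel t
principal-TRUE (nrel _ _) t = axNrel t

Removal : Form → Seq → Seq → Set
Removal D R Out = ∀ {O} → Out ⊆ O → Principal R O D → ΩDer (R ++ O)

Removal-weaken : ∀ {D R Out Out′} → Out ⊆ Out′ → Removal D R Out → Removal D R Out′
Removal-weaken s h t = h (⊆-trans s t)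

remove : ∀ {D R Θ Out} → Removal D R Out → Θ ⊆ D ∷ Out → ΩDer Θ → ΩDer (R ++ Out)
remove-∷ : ∀ {D R Θ Out A} → Removal D R Out → Θ ⊆ D ∷ Out → ΩDer (A ∷ Θ) → ΩDer (R ++ A ∷ Out)
remove-∷-shift : ∀ {D R Θ Out A} → Removal D R Out → Θ ⊆ D ∷ Out → ΩDer (A ∷ Θ) → ΩDer (A ∷ R ++ Out)
remove-++ : ∀ {D R Θ Out} Δ → Removal D R Out → Θ ⊆ D ∷ Out → ΩDer (Δ ++ Θ) → ΩDer (R ++ Δ ++ Out)
remove {R = R} h s (axTrue B t p) with s p
... | here refl = h ⊆-refl (principal-TRUE B t)
... | there q = axTrue B t (∈-++⁺ʳ R q)
remove {R = R} h s (axLog C p q) with s p | s q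
... | here refl | here e = ⊥-elim (neg-irreflexive C e)
... | here refl | there q′ = h ⊆-refl (axLog q′)
... | there p′ | here e = h ⊆-refl (axLog (neg-∈ e p′))
... | there p′ | there q′ = axLog C (∈-++⁺ʳ R p′) (∈-++⁺ʳ R q′)
remove {R = R} h s (andI B C p d₀ d₁) with s p
... | here refl = h ⊆-refl (andI (remove-∷ h s d₀) (remove-∷ h s d₁))
... | there q = andI B C (∈-++⁺ʳ R q) (remove-∷-shift h s d₀) (remove-∷-shift h s d₁)
remove {R = R} h s (orI₀ B C p d) with s p
... | here refl = h ⊆-refl (orI₀ (remove-∷ h s d))
... | there q = orI₀ B C (∈-++⁺ʳ R q) (remove-∷-shift h s d)
remove {R = R} h s (orI₁ B C p d) with s p
... | here refl = h ⊆-refl (orI₁ (remove-∷ h s d))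
... | there q = orI₁ B C (∈-++⁺ʳ R q) (remove-∷-shift h s d)
remove {R = R} h s (allI B p ds) with s p
... | here refl = h ⊆-refl (allI (λ k → remove-∷ h s (ds k)))
... | there q = allI B (∈-++⁺ʳ R q) (λ k → remove-∷-shift h s (ds k))
remove {R = R} h s (exI B p k d) with s p
... | here refl = h ⊆-refl (exI k (remove-∷ h s d))
... | there q = exI B (∈-++⁺ʳ R q) k (remove-∷-shift h s d)
remove {R = R} h s (all2I B p ds) with s p
... | here refl = h ⊆-refl (all2I (λ Y → remove-∷ h s (ds Y)))
... | there q = all2I B (∈-++⁺ʳ R q) (λ Y → remove-∷-shift h s (ds Y))
remove {R = R} h s (Ω B p ds) with s p
... | here refl = h ⊆-refl (Ω (λ Δ π d → remove-++ Δ h s (ds Δ π d)))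
... | there q = Ω B (∈-++⁺ʳ R q) λ Δ π d →
  ΩDer-weaken (⊆-reflexive-↭ (shifts R Δ)) (remove-++ Δ h s (ds Δ π d))
remove h s (cut₀ C r d₀ d₁) = cut₀ C r (remove-∷-shift h s d₀) (remove-∷-shift h s d₁)

remove-∷ h s = remove (Removal-weaken there h) (⊆∷-extend s)

remove-∷-shift {R = R} h s d = ΩDer-weaken (⊆-reflexive-↭ (shift _ R _)) (remove-∷ h s d)

remove-++ Δ h s = remove (Removal-weaken (∈-++⁺ʳ Δ) h) (⊆-trans (++⁺ʳ Δ s) (⊆-reflexive-↭ (shift _ Δ _)))

and-inversion₀ : ∀ {Γ A B} → ΩDer (and A B ∷ Γ) → ΩDer (A ∷ Γ)
and-inversion₀ {Γ} {A} {B} = remove h ⊆-refl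
  where
  h : Removal (and A B) (A ∷ []) Γ
  h s (axLog q) = orI₀ (neg A) (neg B) (there q) (axLog A (there (here refl)) (here refl))
  h s (andI d₀ d₁) = ΩDer-weaken ∷-contract d₀

and-inversion₁ : ∀ {Γ A B} → ΩDer (and A B ∷ Γ) → ΩDer (B ∷ Γ)
and-inversion₁ {Γ} {A} {B} = remove h ⊆-refl
  where
  h : Removal (and A B) (B ∷ []) Γ
  h s (axLog q) = orI₁ (neg A) (neg B) (there q) (axLog B (there (here refl)) (here refl))
  h s (andI d₀ d₁) = ΩDer-weaken ∷-contract d₁

all-inversion : ∀ {Γ A} k → ΩDer (all A ∷ Γ) → ΩDer (inst A k ∷ Γ)
all-inversion {Γ} {A} k = remove h ⊆-refl
  where
  h : Removal (all A) (inst A k ∷ []) Γ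
  h s (axLog q) = exI (neg A) (there q) k (axLog (inst A k) (there (here refl)) (here (sym (inst-neg A k))))
  h s (allI ds) = ΩDer-weaken ∷-contract (ds k)

-- A cut on a compound first-order formula is pushed into the derivation of
-- the side where the formula is introduced by ∨ or ∃ and meets the inverted
-- other side there.
cut-rank : ∀ n {Γ} C → rank C ≤ n → ΩDer (C ∷ Γ) → ΩDer (neg C ∷ Γ) → ΩDer Γ
cut-rank n (rel R ts) _ = cut₀ _ (literal (rel R ts))
cut-rank n (nrel R ts) _ = cut₀ _ (literal (nrel R ts))
cut-rank n (mem X t) _ = cut₀ _ (literal (mem X t))
cut-rank n (nmem X t) _ = cut₀ _ (literal (nmem X t))
cut-rank n (all2 A) _ = cut₀ _ (all2 A)
cut-rank n (ex2 A) _ = cut₀ _ (ex2 A)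
cut-rank (suc n) {Γ} (and A B) r d₀ d₁ = remove h ⊆-refl d₁
  where
  h : Removal (or (neg A) (neg B)) [] Γ
  h {O} s (axLog q) =
    ΩDer-weaken (∈-∷⁺ʳ (subst (_∈ O) (cong₂ and (neg-involutive A) (neg-involutive B)) q) s) d₀
  h s (orI₀ e) = cut-rank n A (≤-trans (m≤m⊔n _ _) (≤-pred r)) (ΩDer-weaken (∷⁺ʳ _ s) (and-inversion₀ d₀)) e
  h s (orI₁ e) = cut-rank n B (≤-trans (m≤n⊔m _ _) (≤-pred r)) (ΩDer-weaken (∷⁺ʳ _ s) (and-inversion₁ d₀)) e
cut-rank (suc n) {Γ} (or A B) r d₀ d₁ = remove h ⊆-refl d₀
  where
  h : Removal (or A B) [] Γ
  h s (axLog q) = ΩDer-weaken (∈-∷⁺ʳ q s) d₁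
  h s (orI₀ e) = cut-rank n A (≤-trans (m≤m⊔n _ _) (≤-pred r)) e (ΩDer-weaken (∷⁺ʳ _ s) (and-inversion₀ d₁))
  h s (orI₁ e) = cut-rank n B (≤-trans (m≤n⊔m _ _) (≤-pred r)) e (ΩDer-weaken (∷⁺ʳ _ s) (and-inversion₁ d₁))
cut-rank (suc n) {Γ} (all A) r d₀ d₁ = remove h ⊆-refl d₁
  where
  h : Removal (ex (neg A)) [] Γ
  h {O} s (axLog q) = ΩDer-weaken (∈-∷⁺ʳ (subst (_∈ O) (cong all (neg-involutive A)) q) s) d₀
  h s (exI k e) = cut-rank n (inst A k) (≤-trans (≤-reflexive (rank-subF _ A)) (≤-pred r))
    (ΩDer-weaken (∷⁺ʳ _ s) (all-inversion k d₀)) (subst (λ C → ΩDer (C ∷ _)) (inst-neg A k) e)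
cut-rank (suc n) {Γ} (ex A) r d₀ d₁ = remove h ⊆-refl d₀
  where
  h : Removal (ex A) [] Γ
  h s (axLog q) = ΩDer-weaken (∈-∷⁺ʳ q s) d₁
  h s (exI k e) = cut-rank n (inst A k) (≤-trans (≤-reflexive (rank-subF _ A)) (≤-pred r))
    e (subst (λ C → ΩDer (C ∷ _)) (inst-neg A k) (ΩDer-weaken (∷⁺ʳ _ s) (all-inversion k d₁)))

cut : ∀ {Γ} C → ΩDer (C ∷ Γ) → ΩDer (neg C ∷ Γ) → ΩDer Γ
cut C = cut-rank (rank C) C ≤-refl

-- Embedding

-- The ∀X-rule of the Ω-system needs premises for all set variables, so the
-- embedding is carried out under an arbitrary substitution of the eigenvariables.
embed-substSet : ∀ {Γ} → Der Γ → (ρ : SetSub) → ΩDer (substSetSeq ρ Γ)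
embed-substSet (AxTrue (rel R ts) t p) ρ = axTrue (rel R ts) t (∈-map⁺ (substSet ρ) p)
embed-substSet (AxTrue (nrel R ts) t p) ρ = axTrue (nrel R ts) t (∈-map⁺ (substSet ρ) p)
embed-substSet (AxLog C p q) ρ =
  axLog (substSet ρ C) (∈-map⁺ (substSet ρ) p) (subst (_∈ _) (substSet-neg ρ C) (∈-map⁺ (substSet ρ) q))
embed-substSet (AndI A₀ A₁ p _ s₀ d₀ _ s₁ d₁) ρ = andI (substSet ρ A₀) (substSet ρ A₁) (∈-map⁺ (substSet ρ) p)
  (ΩDer-weaken (map⁺ _ s₀) (embed-substSet d₀ ρ)) (ΩDer-weaken (map⁺ _ s₁) (embed-substSet d₁ ρ))
embed-substSet (OrI₀ A₀ A₁ p _ s d) ρ =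
  orI₀ (substSet ρ A₀) (substSet ρ A₁) (∈-map⁺ (substSet ρ) p) (ΩDer-weaken (map⁺ _ s) (embed-substSet d ρ))
embed-substSet (OrI₁ A₀ A₁ p _ s d) ρ =
  orI₁ (substSet ρ A₀) (substSet ρ A₁) (∈-map⁺ (substSet ρ) p) (ΩDer-weaken (map⁺ _ s) (embed-substSet d ρ))
embed-substSet (AllI A p _ ss ds) ρ = allI (substSet ρ A) (∈-map⁺ (substSet ρ) p) λ k →
  subst (λ B → ΩDer (B ∷ _)) (substSet-inst ρ A k) (ΩDer-weaken (map⁺ _ (ss k)) (embed-substSet (ds k) ρ))
embed-substSet (ExI A p k _ s d) ρ = exI (substSet ρ A) (∈-map⁺ (substSet ρ) p) k
  (subst (λ B → ΩDer (B ∷ _)) (substSet-inst ρ A k) (ΩDer-weaken (map⁺ _ s) (embed-substSet d ρ)))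
embed-substSet {Γ} (All2I A p Y Y∉Γ _ s d) ρ = all2I A (∈-map⁺ (substSet ρ) p) λ Z →
  subst₂ (λ B Δ → ΩDer (B ∷ Δ))
    (trans (substSet-renX (ρ [ Y ≔ varAbs Z ]) A Y) (cong (substX A) (update-same ρ Y (varAbs Z))))
    (substSetSeq-update ρ Y (varAbs Z) Γ Y∉Γ)
    (ΩDer-weaken (map⁺ _ s) (embed-substSet d (ρ [ Y ≔ varAbs Z ])))
-- Every cut-free derivation of ∀X A, Δ yields one of A(X/T), Δ, to be cut
-- against the premise ¬A(X/T), Γ.
embed-substSet (NAll2I A p T _ s d) ρ = Ω A (∈-map⁺ (substSet ρ) p) λ Δ π e →
  cut (substX A (substSet ρ T))
    (ΩDer-weaken (∷⁺ʳ _ ∈-++⁺ˡ) (fromCutFree (all2-instantiate A (substSet ρ T) π e)))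
    (ΩDer-weaken (∷⁺ʳ _ (∈-++⁺ʳ Δ))
      (subst (λ B → ΩDer (B ∷ _)) (trans (substSet-neg ρ (substX A T)) (cong neg (substSet-substX ρ A T)))
        (ΩDer-weaken (map⁺ _ s) (embed-substSet d ρ))))
embed-substSet (Cut A _ s₀ d₀ _ s₁ d₁) ρ =
  cut (substSet ρ A) (ΩDer-weaken (map⁺ _ s₀) (embed-substSet d₀ ρ))
    (subst (λ B → ΩDer (B ∷ _)) (substSet-neg ρ A) (ΩDer-weaken (map⁺ _ s₁) (embed-substSet d₁ ρ)))

embed : ∀ {Γ} → Der Γ → ΩDer Γ
embed {Γ} d = subst ΩDer (substSetSeq-id Γ) (embed-substSet d varAbs)

-- Collapsing

-- The end-sequent Θ of the derivation being collapsed consists of formulas of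
-- Out and of formulas ∃X¬A for which a cut-free derivation of ∀X A, Out is
-- pending: such a ∃X¬A was introduced by a cut whose other premise has already
-- been collapsed.
Covered : Seq → Seq → List (F ⊤ false 0) → Set
Covered Θ Out Ξ = ∀ {C} → C ∈ Θ → C ∈ Out ⊎ Σ (F ⊤ false 0) λ A → A ∈ Ξ × C ≡ ex2 (neg A)

Pending : Seq → List (F ⊤ false 0) → Set
Pending Out Ξ = All (λ A → CutFreeDer (all2 A ∷ Out)) Ξ

Covered-∷ : ∀ {Θ Out Ξ A} → Covered Θ Out Ξ → Covered (A ∷ Θ) (A ∷ Out) Ξ
Covered-∷ cov (here e) = inj₁ (here e)
Covered-∷ cov (there p) = Sum.map₁ there (cov p)

Covered-++ : ∀ {Θ Out Ξ} → Covered Θ Out Ξ → Covered (Out ++ Θ) Out Ξ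
Covered-++ {Out = Out} cov p = [ inj₁ , cov ]′ (∈-++⁻ Out p)

Covered-pending : ∀ {Θ Out Ξ A C} → C ≡ ex2 (neg A) → Covered Θ Out Ξ → Covered (C ∷ Θ) Out (A ∷ Ξ)
Covered-pending e cov (here refl) = inj₂ (_ , here refl , e)
Covered-pending e cov (there p) = Sum.map₂ (λ (B , b , e′) → B , there b , e′) (cov p)

Pending-∷ : ∀ {Out Ξ A} → Pending Out Ξ → Pending (A ∷ Out) Ξ
Pending-∷ = All.map (CutFreeDer-weaken (∷⁺ʳ _ there))

Covered⇒∈ : ∀ {Θ Out Ξ B} → Covered Θ Out Ξ → B ∈ Θ → (∀ {A} → B ≢ ex2 A) → B ∈ Out
Covered⇒∈ cov p B≢ex2 with cov p
... | inj₁ q = q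
... | inj₂ (_ , _ , e) = ⊥-elim (B≢ex2 e)

Pending-axLog : ∀ {Out Ξ A} → Pending Out Ξ → A ∈ Ξ → all2 (neg (neg A)) ∈ Out → CutFreeDer Out
Pending-axLog {Out} pd a q =
  CutFreeDer-weaken (∈-∷⁺ʳ (subst (λ B → all2 B ∈ Out) (neg-involutive _) q) ⊆-refl) (All.lookup pd a)

ex2-injective : ∀ {A B : F ⊤ false 0} → _≡_ {A = Form} (ex2 A) (ex2 B) → A ≡ B
ex2-injective refl = refl

collapse′ : ∀ {Θ Out Ξ} → Pi1Seq Out → Pending Out Ξ → Covered Θ Out Ξ → ΩDer Θ → CutFreeDer Out
collapse′-∷ : ∀ {Θ Out Ξ B} → Pi1Seq Out → Pi1 B → Pending Out Ξ → Covered Θ Out Ξ →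
              ΩDer (B ∷ Θ) → CutFreeDer (B ∷ Out)

collapse′ π pd cov (axTrue B t p) with cov p
... | inj₁ q = axTrue B t q
... | inj₂ (_ , _ , refl) = ⊥-elim t
collapse′ π pd cov (axLog C p q) with cov p | cov q
... | inj₁ p′ | inj₁ q′ = axLog C p′ q′
... | inj₂ (A , a , refl) | inj₁ q′ = Pending-axLog pd a q′
... | inj₁ p′ | inj₂ (A , a , e) = Pending-axLog pd a (neg-∈ e p′)
... | inj₂ (_ , _ , refl) | inj₂ (_ , _ , ())
collapse′ π pd cov (andI B C p d₀ d₁) =
  andI B C q (collapse′-∷ π (proj₁ (All.lookup π q)) pd cov d₀)
             (collapse′-∷ π (proj₂ (All.lookup π q)) pd cov d₁)
  where q = Covered⇒∈ cov p λ ()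
collapse′ π pd cov (orI₀ B C p d) = orI₀ B C q (collapse′-∷ π (proj₁ (All.lookup π q)) pd cov d)
  where q = Covered⇒∈ cov p λ ()
collapse′ π pd cov (orI₁ B C p d) = orI₁ B C q (collapse′-∷ π (proj₂ (All.lookup π q)) pd cov d)
  where q = Covered⇒∈ cov p λ ()
collapse′ π pd cov (allI B p ds) = allI B q λ k → collapse′-∷ π (Pi1-subF _ B (All.lookup π q)) pd cov (ds k)
  where q = Covered⇒∈ cov p λ ()
collapse′ π pd cov (exI B p k d) = exI B q k (collapse′-∷ π (Pi1-subF _ B (All.lookup π q)) pd cov d)
  where q = Covered⇒∈ cov p λ ()
collapse′ π pd cov (all2I B p ds) = all2I B q λ Y → collapse′-∷ π (Pi1-substX-varAbs B Y) pd cov (ds Y)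
  where q = Covered⇒∈ cov p λ ()
collapse′ {Out = Out} π pd cov (Ω A p ds) with cov p
... | inj₁ q = ⊥-elim (All.lookup π q)
... | inj₂ (A′ , a , e) = collapse′ π pd (Covered-++ cov) (ds Out π pending)
  where
  pending : CutFreeDer (all2 A ∷ Out)
  pending = subst (λ B → CutFreeDer (all2 B ∷ Out)) (sym (neg-injective (ex2-injective e))) (All.lookup pd a)
collapse′ π pd cov (cut₀ _ (literal l) d₀ d₁) =
  literal-cut l (collapse′-∷ π (Literal-Pi1 l) pd cov d₀)
                (collapse′-∷ π (Literal-Pi1 (Literal-neg l)) pd cov d₁)
collapse′ π pd cov (cut₀ _ (all2 A) d₀ d₁) =
  collapse′ π (collapse′-∷ π (Pi1-secondOrderFree A) pd cov d₀ ∷ pd) (Covered-pending refl cov) d₁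
collapse′ π pd cov (cut₀ _ (ex2 A) d₀ d₁) =
  collapse′ π (collapse′-∷ π (Pi1-secondOrderFree (neg A)) pd cov d₁ ∷ pd)
    (Covered-pending (cong F.ex2 (sym (neg-involutive A))) cov) d₀

collapse′-∷ π πB pd cov = collapse′ (πB ∷ π) (Pending-∷ pd) (Covered-∷ cov)

collapse : ∀ {Γ} → Pi1Seq Γ → ΩDer Γ → CutFreeDer Γ
collapse π = collapse′ π [] inj₁

corollary3 : (Γ : Seq) → (d : Der Γ) → Pi1Seq Γ → Σ (Der Γ) CutFree
corollary3 Γ d π = toCutFree (collapse π (embed d))
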